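{- Let $k\in\mathbb{N}_{\geq 2}$. Then $P^{(k)}=K(\mathcal{H}_k)$, i.e. a finite $(k+1)$-hypergraph is the Kay-graph of some finite $k$-hypergraph on the same vertex set if and only if it satisfies condition $(\dagger)$.
   Context: For $m\geq 2$, an $m$-hypergraph is a structure $(V;R)$ with $R\subseteq\binom{V}{m}$, the set of $m$-element subsets of $V$ (viewed as a symmetric irreflexive $m$-ary relation). $\mathcal{H}_k$ is the class of all finite $k$-hypergraphs. For a $k$-hypergraph $H=(V;R)$, its Kay-graph is the $(k+1)$-hypergraph $K(H)=(V;R^{(k+1)})$ where, for $\{x_1,\dots,x_{k+1}\}\in\binom{V}{k+1}$, $\{x_1,\dots,x_{k+1}\}\in R^{(k+1)}$ iff the number of $k$-element subsets of $\{x_1,\dots,x_{k+1}\}$ belonging to $R$ is congruent to $k+1$ modulo $2$. $K(\mathcal{H}_k)=\{K(H):H\in\mathcal{H}_k\}$. $P^{(k)}$ is the class of all finite $(k+1)$-hypergraphs $(V;S)$ satisfying $(\dagger)$: for every $V_0\in\binom{V}{k+2}$, the number of elements of $S$ contained in $V_0$ is congruent to $k$ modulo $2$. -}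

module Defs where

open import Data.Nat using (ℕ; zero; suc; _+_; _%_; _≡ᵇ_)
open import Data.Bool using (Bool; true; false; _∧_; if_then_else_)
open import Data.List using (List; []; _∷_; _++_; map)
open import Data.Nat.ListAction using (sum)
open import Data.Vec using (_∷_; [])
open import Data.Fin.Subset using (Subset; inside; outside; ∣_∣)
open import Data.Fin.Subset.Properties using (_⊆?_)
open import Relation.Nullary using (does)
open import Relation.Binary.PropositionalEquality using (_≡_)

allSubsets : (n : ℕ) → List (Subset n)
allSubsets zero = [] ∷ []
allSubsets (suc n) = map (outside ∷_) (allSubsets n) ++ map (inside ∷_) (allSubsets n)

record Hypergraph (m n : ℕ) : Set where
  field
    edge    : Subset n → Bool
    uniform : ∀ (X : Subset n) → edge X ≡ true → ∣ X ∣ ≡ m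
open Hypergraph public

countIn : {n : ℕ} → ℕ → (Subset n → Bool) → Subset n → ℕ
countIn {n} m e X =
  sum (map (λ Y → if does (Y ⊆? X) ∧ (∣ Y ∣ ≡ᵇ m) ∧ e Y then 1 else 0) (allSubsets n))

kayEdge : {k n : ℕ} → Hypergraph k n → Subset n → Bool
kayEdge {k} H X = (∣ X ∣ ≡ᵇ suc k) ∧ ((countIn k (edge H) X % 2) ≡ᵇ (suc k % 2))

IsKayGraphOf : {k n : ℕ} → Hypergraph (suc k) n → Hypergraph k n → Set
IsKayGraphOf G H = ∀ X → edge G X ≡ kayEdge H X

Dagger : {k n : ℕ} → Hypergraph (suc k) n → Set
Dagger {k} G = ∀ (V0 : Subset _) → ∣ V0 ∣ ≡ suc (suc k) →
  countIn (suc k) (edge G) V0 % 2 ≡ k % 2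

-- Work over GF(2), writing ⨁[ Z , X ] g for the xor of g over the interval Z ⊆ Y ⊆ X of the
-- subset lattice.  The parity of the number of k-edges of H inside a (k+1)-set X is ⨁[ ∅ , X ] H,
-- so X is an edge of K(H) iff G(X) = ⨁[ ∅ , X ] H + k.  If G = K(H) and |V0| = k+2, summing over
-- the (k+1)-subsets of V0 counts every edge of H twice and adds k+2 copies of k, giving (†).
-- Conversely, given (†), let H consist of the k-sets Y avoiding vertex 0 with H(Y) = G({0} ∪ Y) + k.
-- For a (k+1)-set X through 0 the Kay condition holds by construction; for X avoiding 0 it is
-- exactly (†) applied to {0} ∪ X.

module Submission where

open import Defs
open import Algebra.Bundles using (CommutativeRing)
open import Data.Bool using (Bool; true; false; not; _∧_; _xor_; if_then_else_)
open import Data.Bool.Properties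
  using ( not-involutive; ∧-identityʳ; not-distribˡ-xor; not-distribʳ-xor; xor-assoc; xor-same
        ; xor-identityʳ; ∧-comm; ∧-idem; ∧-zeroʳ; ∧-inverseˡ; ∧-conicalˡ; ∧-distribˡ-xor; T-≡
        ; xor-∧-commutativeRing )
open import Algebra.Properties.CommutativeSemigroup
  (CommutativeRing.+-commutativeSemigroup xor-∧-commutativeRing) using (interchange)
open import Data.Fin.Subset using (Subset; inside; outside; ∣_∣; ⊥; _─_)
open import Data.Fin.Subset.Properties using (_⊆?_; p─⊥≡p)
open import Data.List using (List; []; _∷_; _++_; map)
open import Data.List.Properties using (map-++; map-∘)
open import Data.Nat using (ℕ; zero; suc; _+_; _%_; _≡ᵇ_; _≤_; z≤n; s≤s)
open import Data.Nat.ListAction using (sum)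
open import Data.Nat.ListAction.Properties using (sum-++)
open import Data.Nat.Properties using (≡ᵇ⇒≡; ≡⇒≡ᵇ; suc-injective; +-suc; +-cancelʳ-≡; ≤-trans; n≤1+n; <⇒≢)
open import Data.Product using (∃; _,_)
open import Data.Vec using (_∷_; [])
open import Function using (_∘_; _⇔_; mk⇔; Equivalence)
open import Relation.Nullary using (does; contradiction)
open import Relation.Binary.PropositionalEquality
open ≡-Reasoning

odd : ℕ → Bool
odd zero    = false
odd (suc n) = not (odd n)

odd-+ : ∀ m n → odd (m + n) ≡ odd m xor odd n
odd-+ zero    n = refl
odd-+ (suc m) n = trans (cong not (odd-+ m n)) (not-distribˡ-xor (odd m) (odd n))

m%2≡odd : ∀ m → m % 2 ≡ (if odd m then 1 else 0)
m%2≡odd zero          = refl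
m%2≡odd (suc zero)    = refl
m%2≡odd (suc (suc m)) rewrite not-involutive (odd m) = m%2≡odd m

%2-≡ᵇ : ∀ m n → (m % 2 ≡ᵇ n % 2) ≡ not (odd m xor odd n)
%2-≡ᵇ m n rewrite m%2≡odd m | m%2≡odd n with odd m | odd n
... | false | false = refl
... | false | true  = refl
... | true  | false = refl
... | true  | true  = refl

%2≡%2⇔odd≡odd : ∀ m n → (m % 2 ≡ n % 2) ⇔ (odd m ≡ odd n)
%2≡%2⇔odd≡odd m n = mk⇔ to from
  where
  to : m % 2 ≡ n % 2 → odd m ≡ odd n
  to eq with odd m | odd n | trans (sym (m%2≡odd m)) (trans eq (m%2≡odd n))
  ... | false | false | _  = refl
  ... | true  | true  | _  = refl
  ... | false | true  | ()
  ... | true  | false | ()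
  from : odd m ≡ odd n → m % 2 ≡ n % 2
  from eq = trans (m%2≡odd m) (trans (cong (if_then 1 else 0) eq) (sym (m%2≡odd n)))

xor-cancelˡ : ∀ a b → a xor (a xor b) ≡ b
xor-cancelˡ a b = trans (sym (xor-assoc a a b)) (cong (_xor b) (xor-same a))

xor-cancelʳ : ∀ a b → (a xor b) xor b ≡ a
xor-cancelʳ a b = trans (xor-assoc a b b) (trans (cong (a xor_) (xor-same b)) (xor-identityʳ a))

∧-congˡ-true : ∀ a {x y} → (a ≡ true → x ≡ y) → a ∧ x ≡ a ∧ y
∧-congˡ-true false _  = refl
∧-congˡ-true true  eq = eq refl

≡ᵇ-true⇒≡ : ∀ {m n} → (m ≡ᵇ n) ≡ true → m ≡ n
≡ᵇ-true⇒≡ {m} {n} eq = ≡ᵇ⇒≡ m n (Equivalence.from T-≡ eq)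

≡⇒≡ᵇ-true : ∀ {m n} → m ≡ n → (m ≡ᵇ n) ≡ true
≡⇒≡ᵇ-true {m} {n} eq = Equivalence.to T-≡ (≡⇒≡ᵇ m n eq)

≢⇒≡ᵇ-false : ∀ {m n} → m ≢ n → (m ≡ᵇ n) ≡ false
≢⇒≡ᵇ-false {m} {n} m≢n with m ≡ᵇ n in eq
... | false = refl
... | true  = contradiction (≡ᵇ-true⇒≡ eq) m≢n

infix 4 _⊑_

data _⊑_ : ∀ {n} → Subset n → Subset n → Set where
  []   : [] ⊑ []
  omit : ∀ {n} {Y X : Subset n} b → Y ⊑ X → outside ∷ Y ⊑ b ∷ X
  keep : ∀ {n} {Y X : Subset n} → Y ⊑ X → inside ∷ Y ⊑ inside ∷ X

⊥⊑ : ∀ {n} (X : Subset n) → ⊥ ⊑ X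
⊥⊑ []      = []
⊥⊑ (b ∷ X) = omit b (⊥⊑ X)

⊑⇒∣∣≤ : ∀ {n} {Y X : Subset n} → Y ⊑ X → ∣ Y ∣ ≤ ∣ X ∣
⊑⇒∣∣≤ []               = z≤n
⊑⇒∣∣≤ (omit outside Y⊑X) = ⊑⇒∣∣≤ Y⊑X
⊑⇒∣∣≤ (omit inside Y⊑X)  = ≤-trans (⊑⇒∣∣≤ Y⊑X) (n≤1+n _)
⊑⇒∣∣≤ (keep Y⊑X)         = s≤s (⊑⇒∣∣≤ Y⊑X)

∣∣≡∣─∣+∣∣ : ∀ {n} {Y X : Subset n} → Y ⊑ X → ∣ X ∣ ≡ ∣ X ─ Y ∣ + ∣ Y ∣
∣∣≡∣─∣+∣∣ []                 = refl
∣∣≡∣─∣+∣∣ (omit outside Y⊑X) = ∣∣≡∣─∣+∣∣ Y⊑X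
∣∣≡∣─∣+∣∣ (omit inside Y⊑X)  = cong suc (∣∣≡∣─∣+∣∣ Y⊑X)
∣∣≡∣─∣+∣∣ {Y = inside ∷ Y} {inside ∷ X} (keep Y⊑X) =
  trans (cong suc (∣∣≡∣─∣+∣∣ Y⊑X)) (sym (+-suc ∣ X ─ Y ∣ ∣ Y ∣))

infix 7 ⨁[_,_]_

-- ⨁[ Z , X ] g is the xor of g Y over all Y with Z ⊆ Y ⊆ X (false if Z ⊈ X).
⨁[_,_]_ : ∀ {n} → Subset n → Subset n → (Subset n → Bool) → Bool
⨁[ []          , []          ] g = g []
⨁[ inside ∷ Z  , inside ∷ X  ] g = ⨁[ Z , X ] (g ∘ (inside ∷_))
⨁[ inside ∷ Z  , outside ∷ X ] g = false
⨁[ outside ∷ Z , outside ∷ X ] g = ⨁[ Z , X ] (g ∘ (outside ∷_))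
⨁[ outside ∷ Z , inside ∷ X  ] g = ⨁[ Z , X ] (g ∘ (outside ∷_)) xor ⨁[ Z , X ] (g ∘ (inside ∷_))

⨁-cong : ∀ {n} (Z X : Subset n) {g h : Subset n → Bool} →
         (∀ Y → g Y ≡ h Y) → ⨁[ Z , X ] g ≡ ⨁[ Z , X ] h
⨁-cong []            []            g≗h = g≗h []
⨁-cong (inside ∷ Z)  (inside ∷ X)  g≗h = ⨁-cong Z X (g≗h ∘ (inside ∷_))
⨁-cong (inside ∷ Z)  (outside ∷ X) g≗h = refl
⨁-cong (outside ∷ Z) (outside ∷ X) g≗h = ⨁-cong Z X (g≗h ∘ (outside ∷_))
⨁-cong (outside ∷ Z) (inside ∷ X)  g≗h =
  cong₂ _xor_ (⨁-cong Z X (g≗h ∘ (outside ∷_))) (⨁-cong Z X (g≗h ∘ (inside ∷_)))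

⨁-zero : ∀ {n} (Z X : Subset n) {g : Subset n → Bool} →
         (∀ {Y} → Z ⊑ Y → Y ⊑ X → g Y ≡ false) → ⨁[ Z , X ] g ≡ false
⨁-zero []            []            g≡0 = g≡0 [] []
⨁-zero (inside ∷ Z)  (inside ∷ X)  g≡0 = ⨁-zero Z X (λ Z⊑Y Y⊑X → g≡0 (keep Z⊑Y) (keep Y⊑X))
⨁-zero (inside ∷ Z)  (outside ∷ X) g≡0 = refl
⨁-zero (outside ∷ Z) (outside ∷ X) g≡0 =
  ⨁-zero Z X (λ Z⊑Y Y⊑X → g≡0 (omit outside Z⊑Y) (omit outside Y⊑X))
⨁-zero (outside ∷ Z) (inside ∷ X)  g≡0 =
  cong₂ _xor_ (⨁-zero Z X (λ Z⊑Y Y⊑X → g≡0 (omit outside Z⊑Y) (omit inside Y⊑X)))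
              (⨁-zero Z X (λ Z⊑Y Y⊑X → g≡0 (omit inside Z⊑Y) (keep Y⊑X)))

⨁-xor : ∀ {n} (Z X : Subset n) (g h : Subset n → Bool) →
        ⨁[ Z , X ] (λ Y → g Y xor h Y) ≡ ⨁[ Z , X ] g xor ⨁[ Z , X ] h
⨁-xor []            []            g h = refl
⨁-xor (inside ∷ Z)  (inside ∷ X)  g h = ⨁-xor Z X (g ∘ (inside ∷_)) (h ∘ (inside ∷_))
⨁-xor (inside ∷ Z)  (outside ∷ X) g h = refl
⨁-xor (outside ∷ Z) (outside ∷ X) g h = ⨁-xor Z X (g ∘ (outside ∷_)) (h ∘ (outside ∷_))
⨁-xor (outside ∷ Z) (inside ∷ X)  g h =
  trans (cong₂ _xor_ (⨁-xor Z X (g ∘ (outside ∷_)) (h ∘ (outside ∷_)))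
                     (⨁-xor Z X (g ∘ (inside ∷_)) (h ∘ (inside ∷_))))
        (interchange (⨁[ Z , X ] (g ∘ (outside ∷_))) (⨁[ Z , X ] (h ∘ (outside ∷_)))
                     (⨁[ Z , X ] (g ∘ (inside ∷_)))  (⨁[ Z , X ] (h ∘ (inside ∷_))))

⨁-∧ˡ : ∀ {n} a (Z X : Subset n) {g : Subset n → Bool} →
       ⨁[ Z , X ] (λ Y → a ∧ g Y) ≡ a ∧ ⨁[ Z , X ] g
⨁-∧ˡ a []            []            = refl
⨁-∧ˡ a (inside ∷ Z)  (inside ∷ X)  = ⨁-∧ˡ a Z X
⨁-∧ˡ a (inside ∷ Z)  (outside ∷ X) = sym (∧-zeroʳ a)
⨁-∧ˡ a (outside ∷ Z) (outside ∷ X) = ⨁-∧ˡ a Z X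
⨁-∧ˡ a (outside ∷ Z) (inside ∷ X)  =
  trans (cong₂ _xor_ (⨁-∧ˡ a Z X) (⨁-∧ˡ a Z X)) (sym (∧-distribˡ-xor a _ _))

⨁-∧ʳ : ∀ {n} a (Z X : Subset n) {g : Subset n → Bool} →
       ⨁[ Z , X ] (λ Y → g Y ∧ a) ≡ ⨁[ Z , X ] g ∧ a
⨁-∧ʳ a Z X {g} = begin
  ⨁[ Z , X ] (λ Y → g Y ∧ a)  ≡⟨ ⨁-cong Z X (λ Y → ∧-comm (g Y) a) ⟩
  ⨁[ Z , X ] (λ Y → a ∧ g Y)  ≡⟨ ⨁-∧ˡ a Z X ⟩
  a ∧ ⨁[ Z , X ] g            ≡⟨ ∧-comm a _ ⟩
  ⨁[ Z , X ] g ∧ a            ∎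

⨁-top : ∀ {n} {Z X : Subset n} (g : Subset n → Bool) → Z ⊑ X →
        ⨁[ Z , X ] (λ Y → (∣ Y ∣ ≡ᵇ ∣ X ∣) ∧ g Y) ≡ g X
⨁-top g []                 = refl
⨁-top g (omit outside Z⊑X) = ⨁-top (g ∘ (outside ∷_)) Z⊑X
⨁-top g (keep Z⊑X)         = ⨁-top (g ∘ (inside ∷_)) Z⊑X
⨁-top {Z = outside ∷ Z} {inside ∷ X} g (omit inside Z⊑X) =
  cong₂ _xor_ (⨁-zero Z X smaller) (⨁-top (g ∘ (inside ∷_)) Z⊑X)
  where
  smaller : ∀ {Y} → Z ⊑ Y → Y ⊑ X → (∣ Y ∣ ≡ᵇ suc ∣ X ∣) ∧ g (outside ∷ Y) ≡ false
  smaller {Y} _ Y⊑X = cong (_∧ g (outside ∷ Y)) (≢⇒≡ᵇ-false (<⇒≢ (s≤s (⊑⇒∣∣≤ Y⊑X))))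

⨁-coatoms : ∀ {n} {Z X : Subset n} → Z ⊑ X →
            ⨁[ Z , X ] (λ Y → suc ∣ Y ∣ ≡ᵇ ∣ X ∣) ≡ odd ∣ X ─ Z ∣
⨁-coatoms []                 = refl
⨁-coatoms (omit outside Z⊑X) = ⨁-coatoms Z⊑X
⨁-coatoms (keep Z⊑X)         = ⨁-coatoms Z⊑X
⨁-coatoms {Z = outside ∷ Z} {inside ∷ X} (omit inside Z⊑X) =
  cong₂ _xor_ (trans (⨁-cong Z X (λ Y → sym (∧-identityʳ _))) (⨁-top (λ _ → true) Z⊑X))
              (⨁-coatoms Z⊑X)

⨁-size-pred : ∀ {n m} {Z X : Subset n} → Z ⊑ X → ∣ X ∣ ≡ suc m →
              ⨁[ Z , X ] (λ Y → ∣ Y ∣ ≡ᵇ m) ≡ odd ∣ X ─ Z ∣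
⨁-size-pred {Z = Z} {X} Z⊑X ∣X∣≡1+m =
  trans (⨁-cong Z X (λ Y → cong (suc ∣ Y ∣ ≡ᵇ_) (sym ∣X∣≡1+m))) (⨁-coatoms Z⊑X)

⨁-swap : ∀ {n} (X : Subset n) (r : Subset n → Subset n → Bool) →
         ⨁[ ⊥ , X ] (λ Y → ⨁[ ⊥ , Y ] (r Y)) ≡ ⨁[ ⊥ , X ] (λ Z → ⨁[ Z , X ] (λ Y → r Y Z))
⨁-swap []            r = refl
⨁-swap (outside ∷ X) r = ⨁-swap X (λ Y Z → r (outside ∷ Y) (outside ∷ Z))
⨁-swap (inside ∷ X)  r = begin
  ⨁[ ⊥ , X ] (below oo) xor ⨁[ ⊥ , X ] (λ Y → below io Y xor below ii Y)
    ≡⟨ cong (⨁[ ⊥ , X ] (below oo) xor_) (⨁-xor ⊥ X (below io) (below ii)) ⟩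
  ⨁[ ⊥ , X ] (below oo) xor (⨁[ ⊥ , X ] (below io) xor ⨁[ ⊥ , X ] (below ii))
    ≡⟨ sym (xor-assoc (⨁[ ⊥ , X ] (below oo)) _ _) ⟩
  (⨁[ ⊥ , X ] (below oo) xor ⨁[ ⊥ , X ] (below io)) xor ⨁[ ⊥ , X ] (below ii)
    ≡⟨ cong₂ _xor_ (cong₂ _xor_ (⨁-swap X oo) (⨁-swap X io)) (⨁-swap X ii) ⟩
  (⨁[ ⊥ , X ] (above oo) xor ⨁[ ⊥ , X ] (above io)) xor ⨁[ ⊥ , X ] (above ii)
    ≡⟨ cong (_xor ⨁[ ⊥ , X ] (above ii)) (sym (⨁-xor ⊥ X (above oo) (above io))) ⟩
  ⨁[ ⊥ , X ] (λ Z → above oo Z xor above io Z) xor ⨁[ ⊥ , X ] (above ii)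
    ∎
  where
  oo io ii : Subset _ → Subset _ → Bool
  oo Y Z = r (outside ∷ Y) (outside ∷ Z)
  io Y Z = r (inside ∷ Y) (outside ∷ Z)
  ii Y Z = r (inside ∷ Y) (inside ∷ Z)
  below above : (Subset _ → Subset _ → Bool) → Subset _ → Bool
  below s Y = ⨁[ ⊥ , Y ] (s Y)
  above s Z = ⨁[ Z , X ] (λ Y → s Y Z)

⨁-∧-⨁ : ∀ {n} (X : Subset n) (c h : Subset n → Bool) →
        ⨁[ ⊥ , X ] (λ Y → c Y ∧ ⨁[ ⊥ , Y ] h) ≡ ⨁[ ⊥ , X ] (λ Z → ⨁[ Z , X ] c ∧ h Z)
⨁-∧-⨁ X c h = begin
  ⨁[ ⊥ , X ] (λ Y → c Y ∧ ⨁[ ⊥ , Y ] h)          ≡⟨ ⨁-cong ⊥ X (λ Y → sym (⨁-∧ˡ (c Y) ⊥ Y)) ⟩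
  ⨁[ ⊥ , X ] (λ Y → ⨁[ ⊥ , Y ] (λ Z → c Y ∧ h Z)) ≡⟨ ⨁-swap X (λ Y Z → c Y ∧ h Z) ⟩
  ⨁[ ⊥ , X ] (λ Z → ⨁[ Z , X ] (λ Y → c Y ∧ h Z)) ≡⟨ ⨁-cong ⊥ X (λ Z → ⨁-∧ʳ (h Z) Z X) ⟩
  ⨁[ ⊥ , X ] (λ Z → ⨁[ Z , X ] c ∧ h Z)          ∎

sum-map-zero : ∀ {A : Set} (xs : List A) → sum (map (λ _ → 0) xs) ≡ 0
sum-map-zero []       = refl
sum-map-zero (_ ∷ xs) = sum-map-zero xs

odd-sum-allSubsets : ∀ {n} (f : Subset (suc n) → ℕ) →
  odd (sum (map f (allSubsets (suc n)))) ≡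
  odd (sum (map (f ∘ (outside ∷_)) (allSubsets n))) xor odd (sum (map (f ∘ (inside ∷_)) (allSubsets n)))
odd-sum-allSubsets {n} f = begin
  odd (sum (map f (map (outside ∷_) S ++ map (inside ∷_) S)))
    ≡⟨ cong (odd ∘ sum) (map-++ f (map (outside ∷_) S) (map (inside ∷_) S)) ⟩
  odd (sum (map f (map (outside ∷_) S) ++ map f (map (inside ∷_) S)))
    ≡⟨ cong odd (sum-++ (map f (map (outside ∷_) S)) (map f (map (inside ∷_) S))) ⟩
  odd (sum (map f (map (outside ∷_) S)) + sum (map f (map (inside ∷_) S)))
    ≡⟨ odd-+ (sum (map f (map (outside ∷_) S))) (sum (map f (map (inside ∷_) S))) ⟩
  odd (sum (map f (map (outside ∷_) S))) xor odd (sum (map f (map (inside ∷_) S)))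
    ≡⟨ sym (cong₂ _xor_ (cong (odd ∘ sum) (map-∘ S)) (cong (odd ∘ sum) (map-∘ S))) ⟩
  odd (sum (map (f ∘ (outside ∷_)) S)) xor odd (sum (map (f ∘ (inside ∷_)) S))
    ∎
  where
  S : List (Subset n)
  S = allSubsets n

odd-count : ∀ {n} (X : Subset n) (g : Subset n → Bool) →
  odd (sum (map (λ Y → if does (Y ⊆? X) ∧ g Y then 1 else 0) (allSubsets n))) ≡ ⨁[ ⊥ , X ] g
odd-count [] g with g []
... | false = refl
... | true  = refl
odd-count {suc n} (outside ∷ X) g =
  trans (odd-sum-allSubsets (λ Y → if does (Y ⊆? outside ∷ X) ∧ g Y then 1 else 0))
    (trans (cong₂ _xor_ (odd-count X (g ∘ (outside ∷_))) (cong odd (sum-map-zero (allSubsets n))))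
           (xor-identityʳ _))
odd-count {suc n} (inside ∷ X) g =
  trans (odd-sum-allSubsets (λ Y → if does (Y ⊆? inside ∷ X) ∧ g Y then 1 else 0))
    (cong₂ _xor_ (odd-count X (g ∘ (outside ∷_))) (odd-count X (g ∘ (inside ∷_))))

uniform-edge : ∀ {m n} (G : Hypergraph m n) X → edge G X ≡ (∣ X ∣ ≡ᵇ m) ∧ edge G X
uniform-edge G X with edge G X in e
... | false = sym (∧-zeroʳ _)
... | true  = sym (cong (_∧ true) (≡⇒≡ᵇ-true (uniform G X e)))

odd-countIn : ∀ {m n} (G : Hypergraph m n) X → odd (countIn m (edge G) X) ≡ ⨁[ ⊥ , X ] (edge G)
odd-countIn {m} G X =
  trans (odd-count X (λ Y → (∣ Y ∣ ≡ᵇ m) ∧ edge G Y)) (⨁-cong ⊥ X (λ Y → sym (uniform-edge G Y)))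

Dagger⇔⨁ : ∀ {k n} (G : Hypergraph (suc k) n) →
  Dagger G ⇔ (∀ V0 → ∣ V0 ∣ ≡ suc (suc k) → ⨁[ ⊥ , V0 ] (edge G) ≡ odd k)
Dagger⇔⨁ {k} G = mk⇔
  (λ dagger V0 size → trans (sym (odd-countIn G V0))
                            (Equivalence.to (%2≡%2⇔odd≡odd (count V0) k) (dagger V0 size)))
  (λ ⨁≡ V0 size → Equivalence.from (%2≡%2⇔odd≡odd (count V0) k)
                                    (trans (odd-countIn G V0) (⨁≡ V0 size)))
  where
  count : Subset _ → ℕ
  count = countIn (suc k) (edge G)

kayEdge-xor : ∀ {k n} (H : Hypergraph k n) X →
  kayEdge H X ≡ (∣ X ∣ ≡ᵇ suc k) ∧ (⨁[ ⊥ , X ] (edge H) xor odd k)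
kayEdge-xor {k} H X = cong ((∣ X ∣ ≡ᵇ suc k) ∧_) (begin
  (count % 2 ≡ᵇ suc k % 2)              ≡⟨ %2-≡ᵇ count (suc k) ⟩
  not (odd count xor not (odd k))       ≡⟨ not-distribʳ-xor (odd count) (not (odd k)) ⟩
  odd count xor not (not (odd k))       ≡⟨ cong₂ _xor_ (odd-countIn H X) (not-involutive (odd k)) ⟩
  ⨁[ ⊥ , X ] (edge H) xor odd k        ∎)
  where
  count : ℕ
  count = countIn k (edge H) X

⨁⇒IsKayGraphOf : ∀ {k n} (G : Hypergraph (suc k) n) (H : Hypergraph k n) →
  (∀ X → ∣ X ∣ ≡ suc k → ⨁[ ⊥ , X ] (edge H) ≡ edge G X xor odd k) → IsKayGraphOf G H
⨁⇒IsKayGraphOf {k} G H count X = begin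
  edge G X                                              ≡⟨ uniform-edge G X ⟩
  (∣ X ∣ ≡ᵇ suc k) ∧ edge G X                           ≡⟨ ∧-congˡ-true _ recover ⟩
  (∣ X ∣ ≡ᵇ suc k) ∧ (⨁[ ⊥ , X ] (edge H) xor odd k)  ≡⟨ sym (kayEdge-xor H X) ⟩
  kayEdge H X                                           ∎
  where
  recover : (∣ X ∣ ≡ᵇ suc k) ≡ true → edge G X ≡ ⨁[ ⊥ , X ] (edge H) xor odd k
  recover size = trans (sym (xor-cancelʳ (edge G X) (odd k)))
                       (cong (_xor odd k) (sym (count X (≡ᵇ-true⇒≡ size))))

IsKayGraphOf⇒Dagger : ∀ {k n} (G : Hypergraph (suc k) n) (H : Hypergraph k n) →
  IsKayGraphOf G H → Dagger G
IsKayGraphOf⇒Dagger {k} {n} G H G≡KH = Equivalence.from (Dagger⇔⨁ G) ⨁≡odd-k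
  where
  size : Subset n → Bool
  size Y = ∣ Y ∣ ≡ᵇ suc k

  ⨁≡odd-k : ∀ V0 → ∣ V0 ∣ ≡ suc (suc k) → ⨁[ ⊥ , V0 ] (edge G) ≡ odd k
  ⨁≡odd-k V0 ∣V0∣≡k+2 = begin
    ⨁[ ⊥ , V0 ] (edge G)
      ≡⟨ ⨁-cong ⊥ V0 (λ Y → trans (G≡KH Y) (trans (kayEdge-xor H Y) (∧-distribˡ-xor (size Y) _ _))) ⟩
    ⨁[ ⊥ , V0 ] (λ Y → size Y ∧ ⨁[ ⊥ , Y ] (edge H) xor size Y ∧ odd k)
      ≡⟨ ⨁-xor ⊥ V0 (λ Y → size Y ∧ ⨁[ ⊥ , Y ] (edge H)) (λ Y → size Y ∧ odd k) ⟩
    ⨁[ ⊥ , V0 ] (λ Y → size Y ∧ ⨁[ ⊥ , Y ] (edge H)) xor ⨁[ ⊥ , V0 ] (λ Y → size Y ∧ odd k)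
      ≡⟨ cong₂ _xor_ pairs-cancel (⨁-∧ʳ (odd k) ⊥ V0) ⟩
    ⨁[ ⊥ , V0 ] size ∧ odd k
      ≡⟨ cong (_∧ odd k) (trans (⨁-size-pred (⊥⊑ V0) ∣V0∣≡k+2) (cong (odd ∘ ∣_∣) (p─⊥≡p V0))) ⟩
    odd ∣ V0 ∣ ∧ odd k
      ≡⟨ cong (λ m → odd m ∧ odd k) ∣V0∣≡k+2 ⟩
    not (not (odd k)) ∧ odd k
      ≡⟨ trans (cong (_∧ odd k) (not-involutive (odd k))) (∧-idem (odd k)) ⟩
    odd k
      ∎
    where
    -- An edge Z of H lies in exactly the two (k+1)-subsets of V0 above it.
    evenly-covered : ∀ {Z} → Z ⊑ V0 → ⨁[ Z , V0 ] size ∧ edge H Z ≡ false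
    evenly-covered {Z} Z⊑V0 with edge H Z in e
    ... | false = ∧-zeroʳ _
    ... | true  = cong (_∧ true) (trans (⨁-size-pred Z⊑V0 ∣V0∣≡k+2) (cong odd ∣V0─Z∣≡2))
      where
      ∣V0─Z∣≡2 : ∣ V0 ─ Z ∣ ≡ 2
      ∣V0─Z∣≡2 = +-cancelʳ-≡ ∣ Z ∣ _ _
        (trans (sym (∣∣≡∣─∣+∣∣ Z⊑V0)) (trans ∣V0∣≡k+2 (cong (2 +_) (sym (uniform H Z e)))))

    pairs-cancel : ⨁[ ⊥ , V0 ] (λ Y → size Y ∧ ⨁[ ⊥ , Y ] (edge H)) ≡ false
    pairs-cancel = trans (⨁-∧-⨁ V0 size (edge H)) (⨁-zero ⊥ V0 (λ _ Z⊑V0 → evenly-covered Z⊑V0))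

apexPreimage : ∀ {k n} → Hypergraph (suc k) (suc n) → Hypergraph k (suc n)
apexPreimage {k} {n} G = record { edge = link ; uniform = link-uniform }
  where
  link : Subset (suc n) → Bool
  link (inside ∷ Y)  = false
  link (outside ∷ Y) = (∣ Y ∣ ≡ᵇ k) ∧ (edge G (inside ∷ Y) xor odd k)
  link-uniform : ∀ X → link X ≡ true → ∣ X ∣ ≡ k
  link-uniform (outside ∷ Y) eq = ≡ᵇ-true⇒≡ (∧-conicalˡ _ _ eq)

⨁-apexPreimage : ∀ {k n} (G : Hypergraph (suc k) (suc n)) →
  (∀ V0 → ∣ V0 ∣ ≡ suc (suc k) → ⨁[ ⊥ , V0 ] (edge G) ≡ odd k) →
  ∀ X → ∣ X ∣ ≡ suc k → ⨁[ ⊥ , X ] (edge (apexPreimage G)) ≡ edge G X xor odd k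
⨁-apexPreimage {k} G _ (inside ∷ X) ∣X∣≡k+1 =
  trans (cong₂ _xor_ (trans (⨁-cong ⊥ X rephrase) (⨁-top f↑ (⊥⊑ X))) (⨁-zero ⊥ X (λ _ _ → refl)))
        (xor-identityʳ _)
  where
  f↑ : Subset _ → Bool
  f↑ Y = edge G (inside ∷ Y) xor odd k
  rephrase : ∀ Y → (∣ Y ∣ ≡ᵇ k) ∧ f↑ Y ≡ (∣ Y ∣ ≡ᵇ ∣ X ∣) ∧ f↑ Y
  rephrase Y = cong (λ m → (∣ Y ∣ ≡ᵇ m) ∧ f↑ Y) (sym (suc-injective ∣X∣≡k+1))
⨁-apexPreimage {k} G dagger (outside ∷ X) ∣X∣≡k+1 = begin
  ⨁[ ⊥ , X ] (λ Y → size Y ∧ (e↑ Y xor odd k))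
    ≡⟨ ⨁-cong ⊥ X (λ Y → ∧-distribˡ-xor (size Y) (e↑ Y) (odd k)) ⟩
  ⨁[ ⊥ , X ] (λ Y → size Y ∧ e↑ Y xor size Y ∧ odd k)
    ≡⟨ ⨁-xor ⊥ X (λ Y → size Y ∧ e↑ Y) (λ Y → size Y ∧ odd k) ⟩
  ⨁[ ⊥ , X ] (λ Y → size Y ∧ e↑ Y) xor ⨁[ ⊥ , X ] (λ Y → size Y ∧ odd k)
    ≡⟨ cong₂ _xor_ cones (trans (⨁-∧ʳ (odd k) ⊥ X) base) ⟩
  (edge G (outside ∷ X) xor odd k) xor false
    ≡⟨ xor-identityʳ _ ⟩
  edge G (outside ∷ X) xor odd k
    ∎
  where
  size : Subset _ → Bool
  size Y = ∣ Y ∣ ≡ᵇ k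
  e↑ : Subset _ → Bool
  e↑ Y = edge G (inside ∷ Y)

  base : ⨁[ ⊥ , X ] size ∧ odd k ≡ false
  base = begin
    ⨁[ ⊥ , X ] size ∧ odd k  ≡⟨ cong (_∧ odd k) (⨁-size-pred (⊥⊑ X) ∣X∣≡k+1) ⟩
    odd ∣ X ─ ⊥ ∣ ∧ odd k    ≡⟨ cong (λ S → odd ∣ S ∣ ∧ odd k) (p─⊥≡p X) ⟩
    odd ∣ X ∣ ∧ odd k        ≡⟨ cong (λ m → odd m ∧ odd k) ∣X∣≡k+1 ⟩
    not (odd k) ∧ odd k      ≡⟨ ∧-inverseˡ (odd k) ⟩
    false                    ∎

  -- (†) for X ∪ {0}: its (k+1)-subsets are X and the cones {0} ∪ Y over k-subsets Y of X.
  cones : ⨁[ ⊥ , X ] (λ Y → size Y ∧ e↑ Y) ≡ edge G (outside ∷ X) xor odd k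
  cones = trans (sym (xor-cancelˡ (edge G (outside ∷ X)) _)) (cong (edge G (outside ∷ X) xor_) dagger₀)
    where
    top : ⨁[ ⊥ , X ] (edge G ∘ (outside ∷_)) ≡ edge G (outside ∷ X)
    top = trans (⨁-cong ⊥ X (λ Y → trans (uniform-edge G (outside ∷ Y))
                                         (cong (λ m → (∣ Y ∣ ≡ᵇ m) ∧ edge G (outside ∷ Y)) (sym ∣X∣≡k+1))))
                (⨁-top (edge G ∘ (outside ∷_)) (⊥⊑ X))
    dagger₀ : edge G (outside ∷ X) xor ⨁[ ⊥ , X ] (λ Y → size Y ∧ e↑ Y) ≡ odd k
    dagger₀ = trans (cong₂ _xor_ (sym top) (sym (⨁-cong ⊥ X (λ Y → uniform-edge G (inside ∷ Y)))))
                    (dagger (inside ∷ X) (cong suc ∣X∣≡k+1))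

Dagger⇒∃IsKayGraphOf : ∀ {k n} (G : Hypergraph (suc k) n) → Dagger G →
  ∃ (λ (H : Hypergraph k n) → IsKayGraphOf G H)
Dagger⇒∃IsKayGraphOf {k} {zero} G _ = noEdges , ⨁⇒IsKayGraphOf G noEdges (λ { [] () })
  where
  noEdges : Hypergraph k zero
  noEdges = record { edge = λ _ → false ; uniform = λ _ () }
Dagger⇒∃IsKayGraphOf {n = suc n} G dagger =
  apexPreimage G , ⨁⇒IsKayGraphOf G (apexPreimage G) (⨁-apexPreimage G (Equivalence.to (Dagger⇔⨁ G) dagger))

proposition3p2 : (k : ℕ) → 2 ≤ k → (n : ℕ) → (G : Hypergraph (suc k) n) →
    Dagger G ⇔ ∃ (λ (H : Hypergraph k n) → IsKayGraphOf G H)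
proposition3p2 k _ n G = mk⇔ (Dagger⇒∃IsKayGraphOf G) (λ { (H , G≡KH) → IsKayGraphOf⇒Dagger G H G≡KH })
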